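{- For a set $\mathfrak B$ of sets of processes with fusions and a set $A$ of processes with fusions: $\big(\bigvee\mathfrak B\big)|A\subseteq\bigvee\{B|A\mid B\in\mathfrak B\}=\big((\bigcup\mathfrak B)|A\big)^{\perp\perp}$.
   Context: A process with fusions (PWF) is a pair $(P,e)$ of a $\pi$-process $P$ (grammar $P::=\mathbf 0\mid P|Q\mid u^\varepsilon(\vec x).P\mid(\nu x)P$, $\mathbf 0$ inactive) and a fusion $e$ (equivalence relation on names with finite classes); $(P,e)|(Q,f):=(P|Q,ef)$, $ef$ the transitive closure of $e\cup f$; for sets, $A|B:=\{p|q\mid p\in A,q\in B\}$. A pole $\perp\!\!\!\perp$ is a set of closed PWF closed under $\alpha$-equivalence; $p\perp q$ iff the full restriction $\bar\nu(p|q)$ is in $\perp\!\!\!\perp$; $A^\perp:=\{p\mid\forall q\in A,\ p\perp q\}$; $\bigvee\mathfrak B:=(\bigcup\mathfrak B)^{\perp\perp}$. -}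

module Defs where

open import Level using (Level; _⊔_; suc; 0ℓ)
open import Data.Product using (Σ; ∃; _×_; _,_)
open import Relation.Unary using (Pred; _⊆_; _∈_)
open import Relation.Binary using (IsEquivalence)
open import Relation.Binary.PropositionalEquality using (_≡_)

-- An abstract presentation of processes with fusions (PWF), taken up to
-- structural congruence (which contains alpha-equivalence).
record PWFCalculus : Set₁ where
  infixl 6 _∣_
  infix 4 _≃_
  field
    PWF   : Set                      -- processes with fusions (P , e)
    _∣_   : PWF → PWF → PWF          -- (P , e) | (Q , f) = (P | Q , e f)
    _≃_   : PWF → PWF → Set
    ≃-isEquivalence : IsEquivalence _≃_
    ∣-cong  : ∀ {p p′ q q′} → p ≃ p′ → q ≃ q′ → p ∣ q ≃ p′ ∣ q′
    ∣-assoc : ∀ p q r → (p ∣ q) ∣ r ≃ p ∣ (q ∣ r)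
    ∣-comm  : ∀ p q → p ∣ q ≃ q ∣ p
    Closed  : PWF → Set
    ν̄       : PWF → PWF
    ν̄-closed : ∀ p → Closed (ν̄ p)
    ν̄-cong   : ∀ {p q} → p ≃ q → ν̄ p ≃ ν̄ q

module _ (C : PWFCalculus) where
  open PWFCalculus C

  record Pole (ℓ : Level) : Set (suc ℓ) where
    field
      ⫫        : Pred PWF ℓ
      ⫫-closed : ⫫ ⊆ Closed
      ⫫-resp   : ∀ {p q} → p ≃ q → p ∈ ⫫ → q ∈ ⫫

  module _ {ℓ : Level} (pole : Pole ℓ) where
    open Pole pole

    _⊥_ : PWF → PWF → Set ℓ
    p ⊥ q = ν̄ (p ∣ q) ∈ ⫫

    _^⊥ : ∀ {a} → Pred PWF a → Pred PWF (a ⊔ ℓ)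
    (A ^⊥) p = ∀ {q} → q ∈ A → p ⊥ q

    _^⊥⊥ : ∀ {a} → Pred PWF a → Pred PWF (a ⊔ ℓ)
    A ^⊥⊥ = (A ^⊥) ^⊥

    ⋃ : ∀ {a b} → Pred (Pred PWF a) b → Pred PWF (suc a ⊔ b)
    ⋃ 𝔅 p = Σ (Pred _ _) λ B → B ∈ 𝔅 × p ∈ B

    ⋁ : ∀ {a b} → Pred (Pred PWF a) b → Pred PWF (suc a ⊔ b ⊔ ℓ)
    ⋁ 𝔅 = (⋃ 𝔅) ^⊥⊥

  _∣ˢ_ : ∀ {a b} → Pred PWF a → Pred PWF b → Pred PWF (a ⊔ b)
  (A ∣ˢ B) r = Σ PWF λ p → Σ PWF λ q → p ∈ A × q ∈ B × r ≡ p ∣ q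

  -- { B | A  |  B ∈ 𝔅 }  (a set of sets, membership up to extensional equality)
  image∣ : ∀ {a b c} → Pred (Pred PWF a) b → Pred PWF c
         → Pred (Pred PWF (a ⊔ c)) (suc a ⊔ b ⊔ c)
  image∣ {a} 𝔅 A D = Σ (Pred PWF a) λ B → B ∈ 𝔅 × (∀ r → (r ∈ D → r ∈ (B ∣ˢ A)) × (r ∈ (B ∣ˢ A) → r ∈ D))

{-# OPTIONS --safe #-}
-- Since | is associative and commutative up to ≃ and poles are ≃-closed, a
-- component q can be moved across ⊥: s ⊥ (x | q) gives (q | s) ⊥ x.  So for
-- p ∈ X^⊥⊥, q ∈ A and s ∈ (X|A)^⊥ we get q | s ∈ X^⊥, hence p | q ⊥ s, i.e.
-- (X^⊥⊥)|A ⊆ (X|A)^⊥⊥.  Both claims follow, because the union of the sets B|A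
-- with B ∈ 𝔅 is (⋃𝔅)|A.
module Submission where

open import Defs
open import Level using (Level)
open import Function using (_∘_; id)
open import Relation.Unary using (Pred; _⊆_; _≐_; _∈_)
open import Data.Product using (_×_; _,_; proj₁; proj₂)
open import Relation.Binary.PropositionalEquality using (refl)
open import Relation.Binary.Bundles using (Setoid)
import Relation.Binary.Reasoning.Setoid as SetoidReasoning

module _ (C : PWFCalculus) where
  open PWFCalculus C

  ≃-setoid : Setoid _ _
  ≃-setoid = record { isEquivalence = ≃-isEquivalence }

  open Setoid ≃-setoid using (sym)
  open SetoidReasoning ≃-setoid

  ∣-rotate : ∀ p q r → p ∣ (q ∣ r) ≃ (r ∣ p) ∣ q
  ∣-rotate p q r = begin
    p ∣ (q ∣ r)  ≈⟨ ∣-comm p (q ∣ r) ⟩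
    (q ∣ r) ∣ p  ≈⟨ ∣-assoc q r p ⟩
    q ∣ (r ∣ p)  ≈⟨ ∣-comm q (r ∣ p) ⟩
    (r ∣ p) ∣ q  ∎

  module _ {ℓ : Level} (pole : Pole C ℓ) where
    open Pole pole

    variable
      x y : Level
      X : Pred PWF x
      Y : Pred PWF y

    ⊥-resp-≃ : ∀ {p q p′ q′} → p ∣ q ≃ p′ ∣ q′ → _⊥_ C pole p q → _⊥_ C pole p′ q′
    ⊥-resp-≃ eq = ⫫-resp (ν̄-cong eq)

    ^⊥-antitone : X ⊆ Y → _^⊥ C pole Y ⊆ _^⊥ C pole X
    ^⊥-antitone X⊆Y p⊥Y q∈X = p⊥Y (X⊆Y q∈X)

    ^⊥⊥-monotone : X ⊆ Y → _^⊥⊥ C pole X ⊆ _^⊥⊥ C pole Y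
    ^⊥⊥-monotone = ^⊥-antitone ∘ ^⊥-antitone

    ^⊥⊥-cong : X ≐ Y → _^⊥⊥ C pole X ≐ _^⊥⊥ C pole Y
    ^⊥⊥-cong (X⊆Y , Y⊆X) = ^⊥⊥-monotone X⊆Y , ^⊥⊥-monotone Y⊆X

    ^⊥⊥-∣ˢ : ∀ {a} (A : Pred PWF a) →
             _∣ˢ_ C (_^⊥⊥ C pole X) A ⊆ _^⊥⊥ C pole (_∣ˢ_ C X A)
    ^⊥⊥-∣ˢ {X = X} A (p , q , p∈X⊥⊥ , q∈A , refl) {s} s⊥XA =
      ⊥-resp-≃ (sym (∣-assoc p q s)) (p∈X⊥⊥ q∣s∈X⊥)
      where
      q∣s∈X⊥ : q ∣ s ∈ _^⊥ C pole X
      q∣s∈X⊥ {r} r∈X = ⊥-resp-≃ (∣-rotate s r q) (s⊥XA (r , q , r∈X , q∈A , refl))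

    ⋃-image∣ : ∀ {a b c} (𝔅 : Pred (Pred PWF a) b) (A : Pred PWF c) →
               ⋃ C pole (image∣ C 𝔅 A) ≐ _∣ˢ_ C (⋃ C pole 𝔅) A
    ⋃-image∣ 𝔅 A = ⊆-∣ˢ , ∣ˢ-⊆
      where
      ⊆-∣ˢ : ⋃ C pole (image∣ C 𝔅 A) ⊆ _∣ˢ_ C (⋃ C pole 𝔅) A
      ⊆-∣ˢ (D , (B , B∈𝔅 , D≐B∣A) , r∈D) with proj₁ (D≐B∣A _) r∈D
      ... | p , q , p∈B , q∈A , r≡p∣q = p , q , (B , B∈𝔅 , p∈B) , q∈A , r≡p∣q

      ∣ˢ-⊆ : _∣ˢ_ C (⋃ C pole 𝔅) A ⊆ ⋃ C pole (image∣ C 𝔅 A)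
      ∣ˢ-⊆ (p , q , (B , B∈𝔅 , p∈B) , q∈A , r≡p∣q) =
        _∣ˢ_ C B A , (B , B∈𝔅 , λ _ → id , id) , (p , q , p∈B , q∈A , r≡p∣q)

lemma2p40 : ∀ {ℓ a b c} (C : PWFCalculus) (pole : Pole C ℓ)
            (𝔅 : Pred (Pred (PWFCalculus.PWF C) a) b) (A : Pred (PWFCalculus.PWF C) c)
            → (_∣ˢ_ C (⋁ C pole 𝔅) A ⊆ ⋁ C pole (image∣ C 𝔅 A))
              × (⋁ C pole (image∣ C 𝔅 A) ≐ _^⊥⊥ C pole (_∣ˢ_ C (⋃ C pole 𝔅) A))
lemma2p40 C pole 𝔅 A =
  ^⊥⊥-monotone C pole (proj₂ (⋃-image∣ C pole 𝔅 A)) ∘ ^⊥⊥-∣ˢ C pole A ,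
  ^⊥⊥-cong C pole (⋃-image∣ C pole 𝔅 A)
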